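{- Let $\pi=a_1\cdots a_k\in S_n$, where $a_1,\dots,a_k$ are the ascending runs of $\pi$. For each $i$ write $a_i=m_it_i$, where $m_i$ is the first entry of $a_i$ and $t_i$ is the (possibly empty) string obtained by removing $m_i$ from $a_i$. Then $\operatorname{SC}_{132}(\pi)$ avoids $231$ classically if and only if each $m_i$ is a left-to-right minimum of $\pi$ and the concatenation $\operatorname{rev}(t_1)\cdots\operatorname{rev}(t_k)$ is a decreasing sequence.
   Context: $S_n$ is the set of permutations of $[n]$ in one-line notation. An ascending run is a maximal consecutive increasing subsequence. A left-to-right minimum of $\pi=\pi_1\cdots\pi_n$ is an entry $\pi_i$ with $\pi_i<\pi_j$ for all $1\le j<i$. $\operatorname{rev}$ reverses a sequence. Two sequences of distinct integers have the same relative order if replacing the $i$th smallest entry of each by $i$ yields the same word; a permutation contains $\sigma$ classically (resp. consecutively) if some subsequence (resp. consecutive subsequence) has the same relative order as $\sigma$, and avoids it otherwise. $\operatorname{SC}_{132}:S_n\to S_n$ sends a permutation through a stack: at each step, if there is a next input entry and placing it on top of the stack would make the stack contents, read top to bottom, avoid $132$ consecutively, push it; otherwise pop the top entry of the stack to the end of the output; stop when the output has length $n$. -}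

module Defs where

open import Data.Nat using (ℕ; _<_; _<ᵇ_; suc)
open import Data.Bool using (Bool; true; false; _∧_; _∨_; if_then_else_)
open import Data.List using (List; []; _∷_; _++_; reverse; drop; concatMap; map; upTo)
open import Data.Product using (_×_; _,_; ∃-syntax)
open import Data.List.Relation.Unary.All using (All)
open import Data.List.Relation.Binary.Sublist.Propositional using (_⊆_)
open import Relation.Binary.PropositionalEquality using (_≡_)
open import Relation.Nullary using (¬_)
open import Data.List.Relation.Binary.Permutation.Propositional using (_↭_)

IsPerm : ℕ → List ℕ → Set
IsPerm n π = π ↭ map suc (upTo n)

has132c : List ℕ → Bool
has132c (a ∷ b ∷ c ∷ rest) = ((a <ᵇ c) ∧ (c <ᵇ b)) ∨ has132c (b ∷ c ∷ rest)
has132c _ = false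

-- stack as a list, head = top; so the list itself is the contents read top to bottom.
-- popUntil x st : pop entries (returned, in pop order) until pushing x keeps the
-- stack avoiding 132 consecutively; returns (popped, remaining stack)
popUntil : ℕ → List ℕ → List ℕ × List ℕ
popUntil x [] = [] , []
popUntil x (h ∷ st) with has132c (x ∷ h ∷ st)
... | false = [] , h ∷ st
... | true with popUntil x st
...   | (p , st') = h ∷ p , st'

scGo : List ℕ → List ℕ → List ℕ
scGo [] st = st
scGo (x ∷ xs) st with popUntil x st
... | (p , st') = p ++ scGo xs (x ∷ st')

-- SC_132 : stack sort with the stack avoiding consecutive 132 (top to bottom)
SC132 : List ℕ → List ℕ
SC132 π = scGo π []

Contains231 : List ℕ → Set
Contains231 π = ∃[ a ] ∃[ b ] ∃[ c ] ((a ∷ b ∷ c ∷ []) ⊆ π × c < a × a < b)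

Avoids231 : List ℕ → Set
Avoids231 π = ¬ Contains231 π

consRun : ℕ → List (List ℕ) → List (List ℕ)
consRun x [] = (x ∷ []) ∷ []
consRun x ([] ∷ rs) = (x ∷ []) ∷ [] ∷ rs
consRun x ((y ∷ r) ∷ rs) = if x <ᵇ y then (x ∷ y ∷ r) ∷ rs else (x ∷ []) ∷ (y ∷ r) ∷ rs

ascRuns : List ℕ → List (List ℕ)
ascRuns [] = []
ascRuns (x ∷ xs) = consRun x (ascRuns xs)

IsLRMin : List ℕ → ℕ → Set
IsLRMin π v = ∃[ ys ] ∃[ zs ] (π ≡ ys ++ v ∷ zs × All (v <_) ys)

data Decreasing : List ℕ → Set where
  dec[] : Decreasing []
  dec[-] : ∀ {x} → Decreasing (x ∷ [])
  dec∷ : ∀ {x y xs} → y < x → Decreasing (y ∷ xs) → Decreasing (x ∷ y ∷ xs)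

revTails : List ℕ → List ℕ
revTails π = concatMap (λ r → reverse (drop 1 r)) (ascRuns π)

module Submission where

open import Defs
open import Data.Nat using (ℕ)
open import Data.List using (List; _∷_)
open import Data.List.Membership.Propositional using (_∈_)
open import Data.Product using (_×_)
open import Function.Bundles using (_⇔_)

open import Data.Bool using (true; false)
open import Data.Bool.Properties using (T-≡; ¬-not)
open import Data.Empty using (⊥; ⊥-elim)
open import Data.List using ([]; _++_; _ʳ++_; reverse; concat; concatMap; drop; take)
open import Data.List.Properties using (++-assoc; ++-identityʳ; ʳ++-defn; ∷-injective)
open import Data.List.Membership.Propositional using (_∉_; find)
open import Data.List.Membership.Propositional.Properties using (∈-++⁺ˡ; ∈-++⁺ʳ)
open import Data.List.Relation.Unary.All as All using (All; []; _∷_)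
open import Data.List.Relation.Unary.All.Properties using () renaming (++⁺ to All-++⁺)
open import Data.List.Relation.Unary.Any using (Any; here; there)
open import Data.List.Relation.Unary.Any.Properties using () renaming (reverse⁺ to Any-reverse⁺)
open import Data.List.Relation.Unary.AllPairs as AllPairs using (AllPairs; []; _∷_)
open import Data.List.Relation.Unary.Linked using (Linked; []; [-]; _∷_)
open import Data.List.Relation.Unary.Linked.Properties using (Linked⇒AllPairs)
open import Data.List.Relation.Unary.Unique.Propositional using (Unique)
open import Data.List.Relation.Unary.Unique.Propositional.Properties using (map⁺; upTo⁺)
open import Data.List.Relation.Binary.Sublist.Propositional
  using (_⊆_; []; _∷_; _∷ʳ_; ⊆-refl; ⊆-trans; lookup; from∈)
open import Data.List.Relation.Binary.Sublist.Propositional.Properties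
  using (++⁺; ++⁺ˡ; ++⁺ʳ; All-resp-⊆)
open import Data.List.Relation.Binary.Permutation.Propositional
  using (_↭_; ↭-sym; ↭-trans; ↭-reflexive; ↭⇒↭ₛ; module PermutationReasoning)
open import Data.List.Relation.Binary.Permutation.Propositional.Properties
  using (shift; ↭-reverse; All-resp-↭)
  renaming (++⁺ˡ to ↭-++⁺ˡ)
import Data.List.Relation.Binary.Permutation.Setoid.Properties as SetoidPermutation
open import Data.Nat using (_<_; _≤_; _>_; _<ᵇ_; _<?_)
open import Data.Nat.Properties
  using ( <ᵇ-reflects-<; <⇒<ᵇ; <ᵇ⇒<; <-trans; <-asym; <-irrefl; <-cmp; ≤-refl; <⇒≤
        ; ≤-<-trans; <-≤-trans; ≮⇒≥; ≤∧≢⇒<; suc-injective)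
open import Data.Product using (_,_; proj₁; proj₂; ∃-syntax)
open import Function using (flip; _∘_)
open import Function.Bundles using (Equivalence; mk⇔)
open import Relation.Binary.Definitions using (tri<; tri≈; tri>)
open import Relation.Binary.PropositionalEquality
  using (_≡_; _≢_; refl; sym; trans; cong; subst; setoid; module ≡-Reasoning)
open import Relation.Nullary using (¬_; yes; no; ofʸ; ofⁿ)

-- While the heads decrease, the stack is a
-- valley (decreasing, then increasing, read from the top), each run is pushed without pops, and
-- the next, smaller head pops exactly the reversed tail lying above the previous head, so
-- SC₁₃₂(π) = rev(t₁) ⋯ rev(t_k) m_k ⋯ m₁. A decreasing word followed by an increasing one avoids
-- 231, while an ascent u < v in the reversed tails followed by the head of the run of u is a 231.
-- If instead a head m exceeds the previous head, it is smaller than the top of the stack (the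
-- previous run ended), so the pops stop between two stack entries h > m > g and m h g is a 231 of
-- the output. For distinct entries, decreasing heads are exactly heads that are left-to-right minima.

AllPairs-resp-⊆ : ∀ {R : ℕ → ℕ → Set} {xs ys} → xs ⊆ ys → AllPairs R ys → AllPairs R xs
AllPairs-resp-⊆ []           []       = []
AllPairs-resp-⊆ (_ ∷ʳ xs⊆)   (_ ∷ ps) = AllPairs-resp-⊆ xs⊆ ps
AllPairs-resp-⊆ (refl ∷ xs⊆) (p ∷ ps) = All-resp-⊆ xs⊆ p ∷ AllPairs-resp-⊆ xs⊆ ps

Avoids231-resp-⊆ : ∀ {xs ys} → xs ⊆ ys → Avoids231 ys → Avoids231 xs
Avoids231-resp-⊆ xs⊆ys avoids (a , b , c , abc , rest) = avoids (a , b , c , ⊆-trans abc xs⊆ys , rest)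

Unique-resp-↭ : ∀ {xs ys : List ℕ} → xs ↭ ys → Unique xs → Unique ys
Unique-resp-↭ xs↭ys = SetoidPermutation.Unique-resp-↭ (setoid ℕ) (↭⇒↭ₛ xs↭ys)

prefix-unique : ∀ {v : ℕ} xs xs′ {ys ys′} → Unique (xs ++ v ∷ ys) →
                xs ++ v ∷ ys ≡ xs′ ++ v ∷ ys′ → xs ≡ xs′
prefix-unique []       []        _         _  = refl
prefix-unique {v} []   (x ∷ xs′) (v∉ ∷ _) eq with ∷-injective eq
... | refl , ys≡ = ⊥-elim (All.lookup v∉ (subst (v ∈_) (sym ys≡) (∈-++⁺ʳ xs′ (here refl))) refl)
prefix-unique (x ∷ xs) []        (x∉ ∷ _) eq with ∷-injective eq
... | refl , _ = ⊥-elim (All.lookup x∉ (∈-++⁺ʳ xs (here refl)) refl)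
prefix-unique (x ∷ xs) (_ ∷ xs′) (_ ∷ unique) eq with ∷-injective eq
... | refl , eq′ = cong (x ∷_) (prefix-unique xs xs′ unique eq′)

Linked-ʳ++ : ∀ {R : ℕ → ℕ → Set} {h H M} → Linked (flip R) (h ∷ H) → Linked R (h ∷ M) →
             Linked R (H ʳ++ (h ∷ M))
Linked-ʳ++ [-]         lM = lM
Linked-ʳ++ (Rhy ∷ lH) lM = Linked-ʳ++ lH (Rhy ∷ lM)

Decreasing⇒AllPairs : ∀ {L} → Decreasing L → AllPairs _>_ L
Decreasing⇒AllPairs = Linked⇒AllPairs (flip <-trans) ∘ linked
  where
    linked : ∀ {L} → Decreasing L → Linked _>_ L
    linked dec[]           = []
    linked dec[-]          = [-]
    linked (dec∷ y<x dec) = y<x ∷ linked dec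

pairs⇒decreasing : ∀ {L} → (∀ {a b} → (a ∷ b ∷ []) ⊆ L → b < a) → Decreasing L
pairs⇒decreasing {[]}          _     = dec[]
pairs⇒decreasing {_ ∷ []}      _     = dec[-]
pairs⇒decreasing {a ∷ b ∷ L} pairs =
  dec∷ (pairs (++⁺ʳ L ⊆-refl)) (pairs⇒decreasing (λ ab → pairs (a ∷ʳ ab)))

ascent-into-increasing : ∀ {x b c A B} → All (_< x) A → AllPairs _<_ B → (b ∷ c ∷ []) ⊆ A ++ B →
                         x < b → c < x → ⊥
ascent-into-increasing {A = []} _ increasing bc x<b c<x with AllPairs-resp-⊆ bc increasing
... | (b<c ∷ []) ∷ _ = <-asym (<-trans c<x x<b) b<c
ascent-into-increasing {A = _ ∷ _} (_ ∷ below) increasing (_ ∷ʳ bc) =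
  ascent-into-increasing below increasing bc
ascent-into-increasing {A = _ ∷ _} (b<x ∷ _) _ (refl ∷ _) x<b _ = <-asym b<x x<b

decreasing++increasing-avoids231 : ∀ {A B} → AllPairs _>_ A → AllPairs _<_ B → Avoids231 (A ++ B)
decreasing++increasing-avoids231 {[]} _ increasing (a , b , c , abc , c<a , a<b)
  with AllPairs-resp-⊆ abc increasing
... | _ ∷ (b<c ∷ []) ∷ _ = <-asym (<-trans c<a a<b) b<c
decreasing++increasing-avoids231 {_ ∷ _} (_ ∷ decreasing) increasing (a , b , c , (_ ∷ʳ abc) , c<a<b) =
  decreasing++increasing-avoids231 decreasing increasing (a , b , c , abc , c<a<b)
decreasing++increasing-avoids231 {_ ∷ _} (below ∷ _) increasing (a , b , c , (refl ∷ bc) , c<a , a<b) =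
  ascent-into-increasing below increasing bc a<b c<a

avoids231⇒decreasing : ∀ {L H} → Unique (L ++ H) → Avoids231 (L ++ H) → All (λ u → Any (_< u) H) L →
                       Decreasing L
avoids231⇒decreasing {L} {H} unique avoids above = pairs⇒decreasing descent
  where
    descent : ∀ {a b} → (a ∷ b ∷ []) ⊆ L → b < a
    descent {a} {b} ab with <-cmp a b | AllPairs-resp-⊆ (++⁺ʳ H ab) unique
    ... | tri> _ _ b<a | _               = b<a
    ... | tri≈ _ a≡b _ | (a≢b ∷ []) ∷ _ = ⊥-elim (a≢b a≡b)
    ... | tri< a<b _ _ | _ with find (All.lookup above (lookup ab (here refl)))
    ...   | c , c∈H , c<a = ⊥-elim (avoids (a , b , c , ++⁺ ab (from∈ c∈H) , c<a , a<b))

<ᵇ≡true : ∀ {a b} → a < b → (a <ᵇ b) ≡ true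
<ᵇ≡true a<b = Equivalence.to T-≡ (<⇒<ᵇ a<b)

<ᵇ≡false : ∀ {a b} → ¬ a < b → (a <ᵇ b) ≡ false
<ᵇ≡false {a} {b} a≮b = ¬-not (λ e → a≮b (<ᵇ⇒< a b (Equivalence.from T-≡ e)))

has132c-front : ∀ {a b c} r → a < c → c < b → has132c (a ∷ b ∷ c ∷ r) ≡ true
has132c-front r a<c c<b rewrite <ᵇ≡true a<c | <ᵇ≡true c<b = refl

¬has132c-∷ : ∀ {a b} c r → ¬ (a < c × c < b) → has132c (b ∷ c ∷ r) ≡ false →
            has132c (a ∷ b ∷ c ∷ r) ≡ false
¬has132c-∷ {a} {b} c r ¬132 rest with a <? c
... | no a≮c rewrite <ᵇ≡false a≮c = rest
... | yes a<c rewrite <ᵇ≡true a<c | <ᵇ≡false (λ c<b → ¬132 (a<c , c<b)) = rest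

data Valley : List ℕ → Set where
  ascending : ∀ {S} → Linked _<_ S → Valley S
  descend   : ∀ {x y S} → y < x → Valley (y ∷ S) → Valley (x ∷ y ∷ S)

ascending⇒¬has132c : ∀ {S} → Linked _<_ S → has132c S ≡ false
ascending⇒¬has132c []                   = refl
ascending⇒¬has132c [-]                  = refl
ascending⇒¬has132c (_ ∷ [-])            = refl
ascending⇒¬has132c {_ ∷ _ ∷ c ∷ r} (_ ∷ l@(b<c ∷ _)) =
  ¬has132c-∷ c r (λ (_ , c<b) → <-asym b<c c<b) (ascending⇒¬has132c l)

valley⇒¬has132c : ∀ {S} → Valley S → has132c S ≡ false
valley⇒¬has132c (ascending l)                = ascending⇒¬has132c l
valley⇒¬has132c (descend {S = []} _ _)       = refl
valley⇒¬has132c (descend {S = c ∷ r} y<x v) =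
  ¬has132c-∷ c r (λ (x<c , c<y) → <-asym (<-trans c<y y<x) x<c) (valley⇒¬has132c v)

popUntil-keep : ∀ {x h} S → has132c (x ∷ h ∷ S) ≡ false → popUntil x (h ∷ S) ≡ ([] , h ∷ S)
popUntil-keep S no132 rewrite no132 = refl

popUntil-pop : ∀ {x h p S′} S → has132c (x ∷ h ∷ S) ≡ true → popUntil x S ≡ (p , S′) →
               popUntil x (h ∷ S) ≡ (h ∷ p , S′)
popUntil-pop S has132 rest rewrite has132 | rest = refl

popUntil-valley : ∀ {x S} → Valley (x ∷ S) → popUntil x S ≡ ([] , S)
popUntil-valley {S = []}    _ = refl
popUntil-valley {S = _ ∷ S} v = popUntil-keep S (valley⇒¬has132c v)

popUntil-split : ∀ x S → proj₁ (popUntil x S) ++ proj₂ (popUntil x S) ≡ S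
popUntil-split x [] = refl
popUntil-split x (h ∷ S) with has132c (x ∷ h ∷ S)
... | false = refl
... | true  = cong (h ∷_) (popUntil-split x S)

above-head : ∀ {m t} → Linked _<_ (m ∷ t) → All (m <_) t
above-head lt = AllPairs.head (Linked⇒AllPairs <-trans lt)

lastOf : ℕ → List ℕ → ℕ
lastOf m []      = m
lastOf _ (y ∷ t) = lastOf y t

-- D ++ m ∷ [] is strictly decreasing and starts with d (so d = m when D is empty).
data Descent (m : ℕ) : ℕ → List ℕ → Set where
  []  : Descent m m []
  _∷_ : ∀ {d e D} → e < d → Descent m e D → Descent m d (d ∷ D)

bottom≤top : ∀ {m d D} → Descent m d D → m ≤ d
bottom≤top []           = ≤-refl
bottom≤top (e<d ∷ desc) = <⇒≤ (≤-<-trans (bottom≤top desc) e<d)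

top∈ : ∀ {m d D M} → Descent m d D → d ∈ D ++ m ∷ M
top∈ []      = here refl
top∈ (_ ∷ _) = here refl

descent-ʳ++ : ∀ {m d D t} → Descent m d D → Linked _<_ (d ∷ t) → Descent m (lastOf d t) (t ʳ++ D)
descent-ʳ++ desc [-]        = desc
descent-ʳ++ desc (d<y ∷ lt) = descent-ʳ++ (d<y ∷ desc) lt

descent-valley : ∀ {m d D M} → Descent m d D → Linked _<_ (m ∷ M) → Valley (D ++ m ∷ M)
descent-valley []                       lM = ascending lM
descent-valley (m<d ∷ [])               lM = descend m<d (ascending lM)
descent-valley (e<d ∷ desc@(_ ∷ _))     lM = descend e<d (descent-valley desc lM)

popUntil-below : ∀ {x m d D M} → Descent m d D → Linked _<_ (m ∷ M) → x < m →
                 popUntil x (D ++ m ∷ M) ≡ (D , m ∷ M)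
popUntil-below [] lM x<m = popUntil-valley (ascending (x<m ∷ lM))
popUntil-below {M = M} (m<d ∷ []) lM x<m =
  popUntil-pop (_ ∷ M) (has132c-front M x<m m<d) (popUntil-below [] lM x<m)
popUntil-below {m = m} {D = _ ∷ _ ∷ D} {M} (e<d ∷ desc@(_ ∷ _)) lM x<m =
  popUntil-pop _ (has132c-front (D ++ m ∷ M) (<-≤-trans x<m (bottom≤top desc)) e<d)
    (popUntil-below desc lM x<m)

-- Pushing x after these pops puts it directly above h and g: a 231 x h g of the output.
PopStraddles : ℕ → List ℕ → Set
PopStraddles x S = ∃[ p ] ∃[ h ] ∃[ g ] ∃[ S′ ] (popUntil x S ≡ (p , h ∷ g ∷ S′) × g < x × x < h)

popStraddles-∷ : ∀ {x d e} S → e < d → x < d → x ≢ e → Valley (d ∷ e ∷ S) →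
                 (x < e → PopStraddles x (e ∷ S)) → PopStraddles x (d ∷ e ∷ S)
popStraddles-∷ {x} {d} {e} S e<d x<d x≢e v below with <-cmp x e
... | tri< x<e _ _ with below x<e
...   | p , h , g , S′ , popped , g<x , x<h =
  d ∷ p , h , g , S′ , popUntil-pop (e ∷ S) (has132c-front S x<e e<d) popped , g<x , x<h
popStraddles-∷ S e<d x<d x≢e v below | tri≈ _ x≡e _ = ⊥-elim (x≢e x≡e)
popStraddles-∷ {x} {d} {e} S e<d x<d x≢e v below | tri> _ _ e<x =
  [] , d , e , S , popUntil-keep (e ∷ S) no132 , e<x , x<d
  where
    no132 : has132c (x ∷ d ∷ e ∷ S) ≡ false
    no132 = ¬has132c-∷ e S (λ (x<e , _) → <-asym e<x x<e) (valley⇒¬has132c v)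

popUntil-straddles : ∀ {x m d D M} → Descent m d D → Linked _<_ (m ∷ M) → m < x → x < d → x ∉ D →
                     PopStraddles x (D ++ m ∷ M)
popUntil-straddles [] _ m<x x<m _ = ⊥-elim (<-asym m<x x<m)
popUntil-straddles {M = M} (m<d ∷ []) lM m<x x<d _ =
  popStraddles-∷ M m<d x<d (λ x≡m → <-irrefl (sym x≡m) m<x) (descend m<d (ascending lM))
    (λ x<m → ⊥-elim (<-asym m<x x<m))
popUntil-straddles {m = m} {D = _ ∷ _ ∷ D} {M} (e<d ∷ desc@(_ ∷ _)) lM m<x x<d x∉D =
  popStraddles-∷ (D ++ m ∷ M) e<d x<d (x∉D ∘ there ∘ here) (descent-valley (e<d ∷ desc) lM)
    (λ x<e → popUntil-straddles desc lM m<x x<e (x∉D ∘ there))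

scGo-∷ : ∀ {x p S′} xs S → popUntil x S ≡ (p , S′) → scGo (x ∷ xs) S ≡ p ++ scGo xs (x ∷ S′)
scGo-∷ xs S popped rewrite popped = refl

stack⊆scGo : ∀ xs S → S ⊆ scGo xs S
stack⊆scGo []       S = ⊆-refl
stack⊆scGo (x ∷ xs) S = subst (_⊆ scGo (x ∷ xs) S) (popUntil-split x S)
  (++⁺ ⊆-refl (⊆-trans (x ∷ʳ ⊆-refl) (stack⊆scGo xs (x ∷ proj₂ (popUntil x S)))))

scGo-↭ : ∀ xs S → scGo xs S ↭ S ++ xs
scGo-↭ []       S = ↭-reflexive (sym (++-identityʳ S))
scGo-↭ (x ∷ xs) S = begin
  p ++ scGo xs (x ∷ S′)  ↭⟨ ↭-++⁺ˡ p (scGo-↭ xs (x ∷ S′)) ⟩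
  p ++ x ∷ S′ ++ xs      ↭⟨ ↭-++⁺ˡ p (↭-sym (shift x S′ xs)) ⟩
  p ++ S′ ++ x ∷ xs      ≡⟨ ++-assoc p S′ (x ∷ xs) ⟨
  (p ++ S′) ++ x ∷ xs    ≡⟨ cong (_++ x ∷ xs) (popUntil-split x S) ⟩
  S ++ x ∷ xs            ∎
  where
    open PermutationReasoning
    p  = proj₁ (popUntil x S)
    S′ = proj₂ (popUntil x S)

scGo-unique⇒fresh : ∀ {x} xs S → Unique (scGo (x ∷ xs) S) → x ∉ S
scGo-unique⇒fresh {x} xs S unique x∈S
  with Unique-resp-↭ (↭-trans (scGo-↭ (x ∷ xs) S) (shift x S xs)) unique
... | x∉ ∷ _ = All.lookup x∉ (∈-++⁺ˡ x∈S) refl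

straddle⇒231 : ∀ {x} xs S → PopStraddles x S → Contains231 (scGo (x ∷ xs) S)
straddle⇒231 {x} xs S (p , h , g , S′ , popped , g<x , x<h) =
  x , h , g , subst ((x ∷ h ∷ g ∷ []) ⊆_) (sym (scGo-∷ xs S popped))
                (++⁺ˡ p (⊆-trans (++⁺ʳ S′ ⊆-refl) (stack⊆scGo xs (x ∷ h ∷ g ∷ S′)))) ,
  g<x , x<h

scGo-ascending : ∀ {h S t} xs → Valley (h ∷ S) → Linked _<_ (h ∷ t) →
                 scGo (t ++ xs) (h ∷ S) ≡ scGo xs (t ʳ++ (h ∷ S))
scGo-ascending xs v [-]        = refl
scGo-ascending {t = _ ∷ t} xs v (h<y ∷ lt) =
  trans (scGo-∷ (t ++ xs) _ (popUntil-valley (descend h<y v))) (scGo-ascending xs (descend h<y v) lt)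

scGo-pushRun : ∀ {m t M} xs → Linked _<_ (m ∷ t) → Linked _<_ (m ∷ M) →
           scGo (t ++ xs) (m ∷ M) ≡ scGo xs (reverse t ++ m ∷ M)
scGo-pushRun {t = t} xs lt lM = trans (scGo-ascending xs (ascending lM) lt) (cong (scGo xs) (ʳ++-defn t))

scGo-nextHead : ∀ {m t M x} xs → Linked _<_ (m ∷ t) → Linked _<_ (m ∷ M) → x < m →
              scGo (t ++ x ∷ xs) (m ∷ M) ≡ reverse t ++ scGo xs (x ∷ m ∷ M)
scGo-nextHead {m} {t} {M} xs lt lM x<m =
  trans (scGo-pushRun (_ ∷ xs) lt lM)
        (scGo-∷ xs (reverse t ++ m ∷ M) (popUntil-below (descent-ʳ++ [] lt) lM x<m))

-- R splits the input that follows the entry z into its maximal ascending runs.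
data Runs (z : ℕ) : List (List ℕ) → Set where
  []  : Runs z []
  run : ∀ {m t R} → ¬ z < m → Linked _<_ (m ∷ t) → Runs (lastOf m t) R → Runs z ((m ∷ t) ∷ R)

heads : List (List ℕ) → List ℕ
heads = concatMap (take 1)

reversedTails : List (List ℕ) → List ℕ
reversedTails = concatMap (λ r → reverse (drop 1 r))

ascRuns-∷ : ∀ x xs → ∃[ t ] ∃[ R ]
  (ascRuns (x ∷ xs) ≡ (x ∷ t) ∷ R × Linked _<_ (x ∷ t) × Runs (lastOf x t) R × xs ≡ t ++ concat R)
ascRuns-∷ x []       = [] , [] , refl , [-] , [] , refl
ascRuns-∷ x (y ∷ ys) with ascRuns-∷ y ys
... | t , R , runs≡ , lt , runs , refl rewrite runs≡ with x <ᵇ y | <ᵇ-reflects-< x y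
...   | true  | ofʸ x<y = y ∷ t , R , refl , x<y ∷ lt , runs , refl
...   | false | ofⁿ x≮y = [] , (y ∷ t) ∷ R , refl , [-] , run x≮y lt runs , refl

tails-above-heads : ∀ {z R} → Runs z R → All (λ u → Any (_< u) (heads R)) (reversedTails R)
tails-above-heads []                     = []
tails-above-heads (run {t = t} _ lt runs) =
  All-++⁺ (All.map here (All-resp-↭ (↭-sym (↭-reverse t)) (above-head lt)))
          (All.map there (tails-above-heads runs))

scGo-runs : ∀ {m t M z R} → Linked _<_ (m ∷ t) → Linked _<_ (m ∷ M) → Runs z R →
            Linked _>_ (m ∷ heads R) →
            scGo (t ++ concat R) (m ∷ M) ≡ reversedTails ((m ∷ t) ∷ R) ++ (m ∷ heads R) ʳ++ M
scGo-runs {m} {t} {M} lt lM [] _ = begin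
  scGo (t ++ []) (m ∷ M)      ≡⟨ scGo-pushRun [] lt lM ⟩
  reverse t ++ m ∷ M          ≡⟨ cong (_++ m ∷ M) (++-identityʳ (reverse t)) ⟨
  (reverse t ++ []) ++ m ∷ M  ∎
  where open ≡-Reasoning
scGo-runs {m} {t} {M} lt lM (run {x} {t′} {R′} _ lx runs) (x<m ∷ hd) = begin
  scGo (t ++ x ∷ t′ ++ concat R′) (m ∷ M)
    ≡⟨ scGo-nextHead (t′ ++ concat R′) lt lM x<m ⟩
  reverse t ++ scGo (t′ ++ concat R′) (x ∷ m ∷ M)
    ≡⟨ cong (reverse t ++_) (scGo-runs lx (x<m ∷ lM) runs hd) ⟩
  reverse t ++ reversedTails ((x ∷ t′) ∷ R′) ++ (x ∷ heads R′) ʳ++ (m ∷ M)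
    ≡⟨ ++-assoc (reverse t) _ _ ⟨
  (reverse t ++ reversedTails ((x ∷ t′) ∷ R′)) ++ (x ∷ heads R′) ʳ++ (m ∷ M)
    ∎
  where open ≡-Reasoning

SC132-descending-heads : ∀ {x t z R} → Linked _<_ (x ∷ t) → Runs z R → Linked _>_ (x ∷ heads R) →
                         SC132 (x ∷ t ++ concat R) ≡
                           reversedTails ((x ∷ t) ∷ R) ++ reverse (heads ((x ∷ t) ∷ R))
SC132-descending-heads lt = scGo-runs lt [-]

avoids231⇒next-head-below : ∀ {m t M x} xs → Linked _<_ (m ∷ t) → Linked _<_ (m ∷ M) → ¬ lastOf m t < x →
                            x ∉ reverse t ++ m ∷ M → Avoids231 (scGo (x ∷ xs) (reverse t ++ m ∷ M)) →
                            x < m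
avoids231⇒next-head-below {m} {t} {M} {x} xs lt lM last≮x x∉S avoids with <-cmp x m
... | tri< x<m _ _ = x<m
... | tri≈ _ x≡m _ = ⊥-elim (x∉S (∈-++⁺ʳ (reverse t) (here x≡m)))
... | tri> _ _ m<x =
  ⊥-elim (avoids (straddle⇒231 xs (reverse t ++ m ∷ M)
                   (popUntil-straddles desc lM m<x x<last (x∉S ∘ ∈-++⁺ˡ))))
  where
    desc : Descent m (lastOf m t) (reverse t)
    desc = descent-ʳ++ [] lt
    x<last : x < lastOf m t
    x<last = ≤∧≢⇒< (≮⇒≥ last≮x) (λ x≡last → x∉S (subst (_∈ _) (sym x≡last) (top∈ desc)))

avoids231⇒heads-descend : ∀ {m t M R} → Linked _<_ (m ∷ t) → Linked _<_ (m ∷ M) → Runs (lastOf m t) R →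
                          Avoids231 (scGo (t ++ concat R) (m ∷ M)) →
                          Unique (scGo (t ++ concat R) (m ∷ M)) →
                          Linked _>_ (m ∷ heads R)
avoids231⇒heads-descend _ _ [] _ _ = [-]
avoids231⇒heads-descend {m} {t} {M} lt lM (run {x} {t′} {R′} last≮x lx runs) avoids unique =
  x<m ∷ avoids231⇒heads-descend lx (x<m ∷ lM) runs
          (Avoids231-resp-⊆ later avoids) (AllPairs-resp-⊆ later unique)
  where
    xs : List ℕ
    xs = t′ ++ concat R′
    pushed : scGo (t ++ x ∷ xs) (m ∷ M) ≡ scGo (x ∷ xs) (reverse t ++ m ∷ M)
    pushed = scGo-pushRun (x ∷ xs) lt lM
    x<m : x < m
    x<m = avoids231⇒next-head-below xs lt lM last≮x
            (scGo-unique⇒fresh xs _ (subst Unique pushed unique)) (subst Avoids231 pushed avoids)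
    later : scGo xs (x ∷ m ∷ M) ⊆ scGo (t ++ x ∷ xs) (m ∷ M)
    later = subst (_ ⊆_) (sym (scGo-nextHead xs lt lM x<m)) (++⁺ˡ (reverse t) ⊆-refl)

descending-heads⇒LRMin : ∀ {π P h t z R} → π ≡ P ++ h ∷ t ++ concat R → All (h <_) P →
  Linked _<_ (h ∷ t) → Runs z R → Linked _>_ (h ∷ heads R) →
  ∀ {m t′} → (m ∷ t′) ∈ (h ∷ t) ∷ R → IsLRMin π m
descending-heads⇒LRMin {P = P} {t = t} {R = R} π≡ above _ _ _ (here refl) =
  P , t ++ concat R , π≡ , above
descending-heads⇒LRMin {P = P} {h} {t} π≡ above lt (run _ lm runs) (m<h ∷ hd) (there m∈R) =
  descending-heads⇒LRMin (trans π≡ (sym (++-assoc P (h ∷ t) _)))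
    (All-++⁺ (All.map (<-trans m<h) above) (m<h ∷ All.map (<-trans m<h) (above-head lt)))
    lm runs hd m∈R

LRMin⇒descending-heads : ∀ {π P h z R} → Unique π → π ≡ P ++ concat R → h ∈ P → Runs z R →
  (∀ {m t} → (m ∷ t) ∈ R → IsLRMin π m) → Linked _>_ (h ∷ heads R)
LRMin⇒descending-heads _ _ _ [] _ = [-]
LRMin⇒descending-heads {P = P} {h} unique π≡ h∈P (run {m} {t} _ _ runs) lrmin
  with lrmin (here refl)
... | ys , _ , π≡′ , above =
  m<h ∷ LRMin⇒descending-heads unique (trans π≡ (sym (++-assoc P (m ∷ t) _))) (∈-++⁺ʳ P (here refl))
          runs (lrmin ∘ there)
  where
    m<h : m < h
    m<h = All.lookup above
            (subst (h ∈_) (prefix-unique P ys (subst Unique π≡ unique) (trans (sym π≡) π≡′)) h∈P)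

perm⇒unique : ∀ {n π} → IsPerm n π → Unique π
perm⇒unique {n} perm = Unique-resp-↭ (↭-sym perm) (map⁺ suc-injective (upTo⁺ n))

proposition4p1 : (n : ℕ) (π : List ℕ) → IsPerm n π →
    (Avoids231 (SC132 π) ⇔
      ((∀ m t → (m ∷ t) ∈ ascRuns π → IsLRMin π m) × Decreasing (revTails π)))
proposition4p1 n [] _ = mk⇔ (λ _ → (λ _ _ ()) , dec[]) (λ _ → λ { (_ , _ , _ , () , _) })
proposition4p1 n (x ∷ xs) perm with ascRuns-∷ x xs
... | t , R , runs≡ , lt , runs , refl rewrite runs≡ = mk⇔ to from
  where
    π : List ℕ
    π = x ∷ t ++ concat R
    unique : Unique (SC132 π)
    unique = Unique-resp-↭ (↭-sym (scGo-↭ π [])) (perm⇒unique perm)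
    Conditions : Set
    Conditions = (∀ m t′ → (m ∷ t′) ∈ (x ∷ t) ∷ R → IsLRMin π m) × Decreasing (reversedTails ((x ∷ t) ∷ R))
    to : Avoids231 (SC132 π) → Conditions
    to avoids = (λ _ _ → descending-heads⇒LRMin refl [] lt runs hd)
              , avoids231⇒decreasing (subst Unique SC≡ unique) (subst Avoids231 SC≡ avoids)
                  (All.map Any-reverse⁺ (tails-above-heads (run (<-irrefl refl) lt runs)))
      where
        hd : Linked _>_ (x ∷ heads R)
        hd = avoids231⇒heads-descend lt [-] runs avoids unique
        SC≡ : SC132 π ≡ reversedTails ((x ∷ t) ∷ R) ++ reverse (x ∷ heads R)
        SC≡ = SC132-descending-heads lt runs hd
    from : Conditions → Avoids231 (SC132 π)
    from (lrmin , decreasing) = subst Avoids231 (sym (SC132-descending-heads lt runs hd))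
      (decreasing++increasing-avoids231 (Decreasing⇒AllPairs decreasing)
        (Linked⇒AllPairs <-trans (Linked-ʳ++ hd [-])))
      where
        hd : Linked _>_ (x ∷ heads R)
        hd = LRMin⇒descending-heads (perm⇒unique perm) refl (here refl) runs
               (λ m∈R → lrmin _ _ (there m∈R))
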